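{- Let $\mathbb K$ be a field of characteristic zero, $\mathfrak d$ a delta operator on $\mathbb K[x]$, $\mathcal Z=(z_i)_{i\ge0}$ a sequence in $\mathbb K$, and $(t_n(x))_{n\ge0}$ the generalized Gončarov basis associated with $(\mathfrak d,\mathcal Z)$. Let $d(t)\in\mathbb K[[t]]$ be the compositional inverse of the $D$-indicator of $\mathfrak d$. Then, as formal power series in $t$ with coefficients in $\mathbb K[x]$, $$e^{x\,d(t)}=\sum_{n\ge0}\frac1{n!}t_n(x)\,e^{z_n d(t)}\,t^n.$$ In particular, if $\mathfrak d=D$ then $e^{xt}=\sum_{n\ge0}\frac1{n!}t_n(x)e^{z_nt}t^n$.
   Context: $D$ is differentiation $d/dx$. A shift-invariant operator on $\mathbb K[x]$ is a linear operator commuting with all shifts $f(x)\mapsto f(x+a)$; a delta operator is a shift-invariant operator $\mathfrak d$ with $\mathfrak d(x)$ a nonzero constant. Every shift-invariant operator $\mathfrak s$ can be written uniquely as $\mathfrak s=q(D)=\sum_{k\ge0}\frac{a_k}{k!}D^k$ for a formal power series $q(t)=\sum_k\frac{a_k}{k!}t^k$, called the $D$-indicator of $\mathfrak s$; for a delta operator, $q(0)=0$ and $q'(0)\ne0$, so $q$ has a compositional inverse. The generalized Gončarov basis associated with $(\mathfrak d,\mathcal Z)$ is the unique sequence of polynomials $(t_n)_{n\ge0}$ with $\deg t_n=n$ and $\varepsilon_{z_i}(\mathfrak d^i t_n)=n!\,\delta_{i,n}$ for all $i,n$ ($\varepsilon_z$ evaluation at $z$, $\mathfrak d^i$ the $i$-th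 iterate). -}

module Defs where

open import Level using (Level) renaming (suc to lsuc)
open import Algebra.Bundles using (CommutativeRing)
open import Data.Nat using (ℕ; zero; suc; _≤_; _<_; _<?_; _≤?_; _≟_; _∸_; _!) renaming (_⊔_ to _⊔ℕ_)
  renaming (_+_ to _+ℕ_)
open import Data.Nat.Combinatorics using (_C_)
open import Data.Product using (Σ; _×_; _,_)
open import Relation.Nullary using (¬_; yes; no)
open import Relation.Nullary.Negation using (contradiction)

natEmb : ∀ {c ℓ} (R : CommutativeRing c ℓ) → ℕ → CommutativeRing.Carrier R
natEmb R zero    = CommutativeRing.0# R
natEmb R (suc n) = CommutativeRing._+_ R (CommutativeRing.1# R) (natEmb R n)

-- A field of characteristic zero: a commutative ring with a (total)
-- inverse map which is a genuine inverse on every nonzero element, and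
-- in which n·1 ≠ 0 for every n ≥ 1 (this also gives 1 ≠ 0).

record CharZeroField (c ℓ : Level) : Set (lsuc (c Level.⊔ ℓ)) where
  field
    commutativeRing : CommutativeRing c ℓ
  open CommutativeRing commutativeRing public
  field
    _⁻¹      : Carrier → Carrier
    inverseʳ : ∀ x → ¬ (x ≈ 0#) → x * (x ⁻¹) ≈ 1#
    charZero : ∀ n → ¬ (natEmb commutativeRing (suc n) ≈ 0#)

module Theory {c ℓ} (F : CharZeroField c ℓ) where
  open CharZeroField F public

  K : Set c
  K = Carrier

  ι : ℕ → K
  ι = natEmb commutativeRing

  fact : ℕ → K
  fact n = ι (n !)

  pow : K → ℕ → K
  pow a zero    = 1#
  pow a (suc n) = a * pow a n

  sumK : ℕ → (ℕ → K) → K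
  sumK zero    f = 0#
  sumK (suc n) f = sumK n f + f n

  ifLe : ℕ → ℕ → K → K
  ifLe k j a with k ≤? j
  ... | yes _ = a
  ... | no  _ = 0#

  ifEq : ℕ → ℕ → K → K
  ifEq i n a with i ≟ n
  ... | yes _ = a
  ... | no  _ = 0#

  -- Polynomials 𝕂[x]: coefficient sequences (coeff k = coefficient of
  -- x^k) together with a bound beyond which all coefficients vanish.

  record Poly : Set (c Level.⊔ ℓ) where
    field
      coeff  : ℕ → K
      bound  : ℕ
      vanish : ∀ k → bound ≤ k → coeff k ≈ 0#
  open Poly public

  truncate : (ℕ → K) → ℕ → ℕ → K
  truncate f N k with k <? N
  ... | yes _ = f k
  ... | no  _ = 0#

  truncate-vanish : ∀ f N k → N ≤ k → truncate f N k ≈ 0#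
  truncate-vanish f N k N≤k with k <? N
  ... | yes k<N = contradiction N≤k (Data.Nat.Properties.<⇒≱ k<N)
    where import Data.Nat.Properties
  ... | no  _   = refl

  mkPoly : (ℕ → K) → ℕ → Poly
  mkPoly f N = record { coeff = truncate f N ; bound = N ; vanish = truncate-vanish f N }

  infix 4 _≈ₚ_
  _≈ₚ_ : Poly → Poly → Set ℓ
  f ≈ₚ g = ∀ k → coeff f k ≈ coeff g k

  constP : K → Poly
  constP a = mkPoly (λ _ → a) 1

  0ₚ : Poly
  0ₚ = constP 0#

  1ₚ : Poly
  1ₚ = constP 1#

  xP : Poly
  xP = mkPoly (λ k → ifEq k 1 1#) 2

  infixl 6 _+ₚ_
  _+ₚ_ : Poly → Poly → Poly
  f +ₚ g = mkPoly (λ k → coeff f k + coeff g k) (bound f ⊔ℕ bound g)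

  infixl 7 _·ₚ_
  _·ₚ_ : K → Poly → Poly
  a ·ₚ f = mkPoly (λ k → a * coeff f k) (bound f)

  infixl 7 _*ₚ_
  _*ₚ_ : Poly → Poly → Poly
  f *ₚ g = mkPoly (λ k → sumK (suc k) (λ i → coeff f i * coeff g (k ∸ i)))
                  (bound f +ℕ bound g)

  sumP : ℕ → (ℕ → Poly) → Poly
  sumP zero    F = 0ₚ
  sumP (suc n) F = sumP n F +ₚ F n

  iter : (Poly → Poly) → ℕ → Poly → Poly
  iter T zero    f = f
  iter T (suc n) f = T (iter T n f)

  Dx : Poly → Poly
  Dx f = mkPoly (λ k → ι (suc k) * coeff f (suc k)) (bound f)

  -- shift f(x) ↦ f(x + a):  coefficient of x^k is Σ_j C(j,k) a^{j-k} f_j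
  shift : K → Poly → Poly
  shift a f = mkPoly (λ k → sumK (bound f)
                        (λ j → ifLe k j (ι (j C k) * pow a (j ∸ k) * coeff f j)))
                     (bound f)

  eval : K → Poly → K
  eval z f = sumK (bound f) (λ j → coeff f j * pow z j)

  HasDegree : Poly → ℕ → Set ℓ
  HasDegree f n = ¬ (coeff f n ≈ 0#) × (∀ k → n < k → coeff f k ≈ 0#)

  IsLinear : (Poly → Poly) → Set (c Level.⊔ ℓ)
  IsLinear T = (∀ f g → f ≈ₚ g → T f ≈ₚ T g)
             × (∀ f g → T (f +ₚ g) ≈ₚ T f +ₚ T g)
             × (∀ a f → T (a ·ₚ f) ≈ₚ a ·ₚ T f)

  IsShiftInvariant : (Poly → Poly) → Set (c Level.⊔ ℓ)
  IsShiftInvariant T = ∀ a f → T (shift a f) ≈ₚ shift a (T f)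

  IsDeltaOperator : (Poly → Poly) → Set (c Level.⊔ ℓ)
  IsDeltaOperator T = IsLinear T × IsShiftInvariant T
                    × Σ K (λ b → ¬ (b ≈ 0#) × (T xP ≈ₚ constP b))

  PS : ∀ {a} → Set a → Set a
  PS A = ℕ → A

  -- q is the D-indicator of T:  T = q(D) = Σ_k q_k D^k
  -- (on f, D^k f = 0 for k > bound f, so the sum is finite)
  IsDIndicator : PS K → (Poly → Poly) → Set (c Level.⊔ ℓ)
  IsDIndicator q T = ∀ f → T f ≈ₚ sumP (suc (bound f)) (λ k → q k ·ₚ iter Dx k f)

  oneS : PS K
  oneS m = ifEq m 0 1#

  tS : PS K
  tS m = ifEq m 1 1#

  mulS : PS K → PS K → PS K
  mulS f g m = sumK (suc m) (λ i → f i * g (m ∸ i))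

  powS : PS K → ℕ → PS K
  powS g zero    = oneS
  powS g (suc k) = mulS g (powS g k)

  -- composition f(g(t)) for g with zero constant term
  compS : PS K → PS K → PS K
  compS f g m = sumK (suc m) (λ k → f k * powS g k m)

  IsCompInverse : PS K → PS K → Set ℓ
  IsCompInverse d q = (d 0 ≈ 0#)
                    × (∀ m → compS q d m ≈ tS m)
                    × (∀ m → compS d q m ≈ tS m)

  expS : PS K
  expS k = (fact k) ⁻¹

  oneSP : PS Poly
  oneSP m = mkPoly (λ _ → ifEq m 0 1#) 1

  mulSP : PS Poly → PS Poly → PS Poly
  mulSP f g m = sumP (suc m) (λ i → f i *ₚ g (m ∸ i))

  powSP : PS Poly → ℕ → PS Poly
  powSP g zero    = oneSP
  powSP g (suc k) = mulSP g (powSP g k)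

  -- composition f(g(t)), f with coefficients in 𝕂, g over 𝕂[x] with
  -- zero constant term
  compSP : PS K → PS Poly → PS Poly
  compSP f g m = sumP (suc m) (λ k → f k ·ₚ powSP g k m)

  IsGoncarovBasis : (Poly → Poly) → (ℕ → K) → (ℕ → Poly) → Set ℓ
  IsGoncarovBasis T z t =
    ∀ n → HasDegree (t n) n
        × (∀ i → eval (z i) (iter T i (t n)) ≈ ifEq i n (fact n))

  expXd : PS K → PS Poly
  expXd d = compSP expS (λ m → d m ·ₚ xP)

  -- Σ_n (1/n!) t_n(x) e^{z_n d(t)} t^n ; coefficient of t^m
  goncarovSeries : PS K → (ℕ → K) → (ℕ → Poly) → PS Poly
  goncarovSeries d z t m =
    sumP (suc m) (λ n → ((fact n) ⁻¹ * compS expS (λ r → z n * d r) (m ∸ n)) ·ₚ t n)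

-- Write E(t) = e^{x d(t)} = Σ_m A_m(x) t^m, so that the coefficient of x^k in A_m is
-- [t^m] d(t)^k / k!.  Since D acts on E as multiplication by d(t) and 𝔡 = q(D),
-- 𝔡 acts on E as multiplication by q(d(t)) = t, i.e. 𝔡 A_m = A_{m-1}.  Hence
-- ε_{z_i} 𝔡^i A_m = [t^{m-i}] e^{z_i d(t)} for i ≤ m and 0 otherwise, which are also the
-- values of ε_{z_i} 𝔡^i on the right-hand side, by the defining property of (t_n).
-- As 𝔡 lowers degrees and deg t_n = n, the functionals ε_{z_i} 𝔡^i separate
-- polynomials (peel off the top coefficient against t_n), so both sides agree.
-- Only the linearity of 𝔡 and 𝔡 = q(D) are used, not shift invariance or 𝔡(x) ≠ 0.

module Submission where

open import Defs
open import Data.Nat using (ℕ; zero; suc; _≤_; _<_; _<?_; _≤?_; _≟_; _∸_; _!; z≤n; s≤s)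
  renaming (_+_ to _+ℕ_; _*_ to _*ℕ_; _⊔_ to _⊔ℕ_)
import Data.Nat.Properties as ℕ
import Level
open import Data.Product using (_,_; proj₁; proj₂)
open import Data.Sum using (inj₁; inj₂)
open import Relation.Nullary using (¬_; yes; no)
open import Relation.Nullary.Negation using (contradiction)
open import Relation.Binary.PropositionalEquality as ≡ using (_≡_)
import Algebra.Properties.CommutativeSemigroup as CommutativeSemigroupProperties
import Algebra.Properties.Group as GroupProperties
import Algebra.Properties.Ring as RingProperties
import Relation.Binary.Reasoning.Setoid as SetoidReasoning

module _ {c ℓ} (F : CharZeroField c ℓ) where
  open Theory F
  open SetoidReasoning setoid
  open CommutativeSemigroupProperties +-commutativeSemigroup using ()
    renaming (interchange to +-interchange)
  open CommutativeSemigroupProperties *-commutativeSemigroup using ()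
    renaming (interchange to *-interchange; x∙yz≈y∙xz to *-exchange; xy∙z≈x∙zy to *-swapʳ)
  open RingProperties ring using (-1*x≈-x)
  open GroupProperties +-group using ()
    renaming (x∙y⁻¹≈ε⇒x≈y to x-y≈0⇒x≈y; x≈y⇒x∙y⁻¹≈ε to x≈y⇒x-y≈0)

  VanishesFrom : (ℕ → K) → ℕ → Set ℓ
  VanishesFrom f N = ∀ k → N ≤ k → f k ≈ 0#

  vanishesFrom-mono : ∀ {f M N} → M ≤ N → VanishesFrom f M → VanishesFrom f N
  vanishesFrom-mono M≤N van k N≤k = van k (ℕ.≤-trans M≤N N≤k)

  vanishesFrom-pred : ∀ {f M} → VanishesFrom f (suc M) → f M ≈ 0# → VanishesFrom f M
  vanishesFrom-pred {M = M} van fM≈0 k M≤k with ℕ.m≤n⇒m<n∨m≡n M≤k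
  ... | inj₁ M<k     = van k M<k
  ... | inj₂ ≡.refl = fM≈0

  -- Finite sums

  sumK-cong : ∀ N {f g : ℕ → K} → (∀ i → i < N → f i ≈ g i) → sumK N f ≈ sumK N g
  sumK-cong zero    f≈g = refl
  sumK-cong (suc N) f≈g =
    +-cong (sumK-cong N (λ i i<N → f≈g i (ℕ.m<n⇒m<1+n i<N))) (f≈g N (ℕ.n<1+n N))

  sumK-zero : ∀ N {f : ℕ → K} → (∀ i → i < N → f i ≈ 0#) → sumK N f ≈ 0#
  sumK-zero N f≈0 = trans (sumK-cong N f≈0) (sumK-const-0 N)
    where
    sumK-const-0 : ∀ N → sumK N (λ _ → 0#) ≈ 0#
    sumK-const-0 zero    = refl
    sumK-const-0 (suc N) = trans (+-identityʳ _) (sumK-const-0 N)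

  sumK-+ : ∀ N (f g : ℕ → K) → sumK N (λ i → f i + g i) ≈ sumK N f + sumK N g
  sumK-+ zero    f g = sym (+-identityˡ 0#)
  sumK-+ (suc N) f g = trans (+-cong (sumK-+ N f g) refl) (+-interchange _ _ _ _)

  *-distribˡ-sumK : ∀ N a (f : ℕ → K) → a * sumK N f ≈ sumK N (λ i → a * f i)
  *-distribˡ-sumK zero    a f = zeroʳ a
  *-distribˡ-sumK (suc N) a f = trans (distribˡ a _ _) (+-cong (*-distribˡ-sumK N a f) refl)

  sumK-comm : ∀ N M (f : ℕ → ℕ → K) →
              sumK N (λ i → sumK M (f i)) ≈ sumK M (λ j → sumK N (λ i → f i j))
  sumK-comm zero    M f = sym (sumK-zero M (λ _ _ → refl))
  sumK-comm (suc N) M f = trans (+-cong (sumK-comm N M f) refl) (sym (sumK-+ M _ _))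

  sumK-extend : ∀ {f} L N → L ≤ N → VanishesFrom f L → sumK N f ≈ sumK L f
  sumK-extend _ zero    z≤n    _   = refl
  sumK-extend L (suc N) L≤1+N van with ℕ.m≤n⇒m<n∨m≡n L≤1+N
  ... | inj₁ (s≤s L≤N) = trans (+-cong (sumK-extend L N L≤N van) (van N L≤N)) (+-identityʳ _)
  ... | inj₂ ≡.refl    = refl

  sumK-support : ∀ {f} L M → VanishesFrom f L → VanishesFrom f M → sumK L f ≈ sumK M f
  sumK-support L M vanL vanM with ℕ.≤-total L M
  ... | inj₁ L≤M = sym (sumK-extend L M L≤M vanL)
  ... | inj₂ M≤L = sumK-extend M L M≤L vanM

  ifEq-≡ : ∀ i n a → i ≡ n → ifEq i n a ≈ a
  ifEq-≡ i n a i≡n with i ≟ n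
  ... | yes _   = refl
  ... | no  i≢n = contradiction i≡n i≢n

  ifEq-≢ : ∀ i n a → ¬ i ≡ n → ifEq i n a ≈ 0#
  ifEq-≢ i n a i≢n with i ≟ n
  ... | yes i≡n = contradiction i≡n i≢n
  ... | no  _   = refl

  ifEq-cong : ∀ i n {a b} → a ≈ b → ifEq i n a ≈ ifEq i n b
  ifEq-cong i n a≈b with i ≟ n
  ... | yes _ = a≈b
  ... | no  _ = refl

  ifEq-suc : ∀ i n a → ifEq (suc i) (suc n) a ≈ ifEq i n a
  ifEq-suc i n a with i ≟ n
  ... | yes i≡n = ifEq-≡ (suc i) (suc n) a (≡.cong suc i≡n)
  ... | no  i≢n = ifEq-≢ (suc i) (suc n) a (λ e → i≢n (ℕ.suc-injective e))

  *-ifEq : ∀ i n a b → a * ifEq i n b ≈ ifEq i n (a * b)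
  *-ifEq i n a b with i ≟ n
  ... | yes _ = refl
  ... | no  _ = zeroʳ a

  sumK-ifEq : ∀ N i n (f : ℕ → K) → sumK N (λ j → ifEq i n (f j)) ≈ ifEq i n (sumK N f)
  sumK-ifEq N i n f with i ≟ n
  ... | yes _ = refl
  ... | no  _ = sumK-zero N (λ _ _ → refl)

  sumK-ifEq-≥ : ∀ N k (f : ℕ → K) → N ≤ k → sumK N (λ j → ifEq k j (f j)) ≈ 0#
  sumK-ifEq-≥ N k f N≤k =
    sumK-zero N (λ j j<N → ifEq-≢ k j (f j) (λ { ≡.refl → ℕ.<⇒≱ j<N N≤k }))

  sumK-ifEq-< : ∀ N k (f : ℕ → K) → k < N → sumK N (λ j → ifEq k j (f j)) ≈ f k
  sumK-ifEq-< (suc N) k f (s≤s k≤N) with ℕ.m≤n⇒m<n∨m≡n k≤N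
  ... | inj₁ k<N = trans (+-cong (sumK-ifEq-< N k f k<N) (ifEq-≢ k N (f N) (ℕ.<⇒≢ k<N)))
                         (+-identityʳ _)
  ... | inj₂ ≡.refl = trans (+-cong (sumK-ifEq-≥ N N f ℕ.≤-refl) (ifEq-≡ N N (f N) ≡.refl))
                            (+-identityˡ _)

  zeroʳ-nested : ∀ a b {x} → x ≈ 0# → a * (b * x) ≈ 0#
  zeroʳ-nested a b x≈0 = trans (*-cong refl (trans (*-cong refl x≈0) (zeroʳ b))) (zeroʳ a)

  noZeroDivisorʳ : ∀ {a b} → ¬ b ≈ 0# → a * b ≈ 0# → a ≈ 0#
  noZeroDivisorʳ {a} {b} b≉0 ab≈0 = begin
    a                ≈⟨ sym (*-identityʳ a) ⟩
    a * 1#           ≈⟨ *-cong refl (sym (inverseʳ b b≉0)) ⟩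
    a * (b * b ⁻¹)   ≈⟨ sym (*-assoc a b _) ⟩
    (a * b) * b ⁻¹   ≈⟨ *-cong ab≈0 refl ⟩
    0# * b ⁻¹        ≈⟨ zeroˡ _ ⟩
    0#               ∎

  x≈y⇒x+-1y≈0 : ∀ {x y} → x ≈ y → x + - 1# * y ≈ 0#
  x≈y⇒x+-1y≈0 x≈y = trans (+-cong refl (-1*x≈-x _)) (x≈y⇒x-y≈0 x≈y)

  x+-1y≈0⇒x≈y : ∀ {x y} → x + - 1# * y ≈ 0# → x ≈ y
  x+-1y≈0⇒x≈y eq = x-y≈0⇒x≈y _ _ (trans (+-cong refl (sym (-1*x≈-x _))) eq)

  ι-+ : ∀ a b → ι (a +ℕ b) ≈ ι a + ι b
  ι-+ zero    b = sym (+-identityˡ _)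
  ι-+ (suc a) b = trans (+-cong refl (ι-+ a b)) (sym (+-assoc _ _ _))

  ι-* : ∀ a b → ι (a *ℕ b) ≈ ι a * ι b
  ι-* zero    b = sym (zeroˡ _)
  ι-* (suc a) b = trans (ι-+ b (a *ℕ b))
    (trans (+-cong (sym (*-identityˡ _)) (ι-* a b)) (sym (distribʳ _ _ _)))

  fact≉0 : ∀ n → ¬ fact n ≈ 0#
  fact≉0 n with n ! | ℕ.1≤n! n
  ... | suc p | _ = charZero p

  fact-*-expS : ∀ n → fact n * expS n ≈ 1#
  fact-*-expS n = inverseʳ (fact n) (fact≉0 n)

  expS-*-fact-cancel : ∀ n a → (expS n * a) * fact n ≈ a
  expS-*-fact-cancel n a = begin
    (expS n * a) * fact n   ≈⟨ *-swapʳ _ _ _ ⟩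
    expS n * (fact n * a)   ≈⟨ sym (*-assoc _ _ _) ⟩
    (expS n * fact n) * a   ≈⟨ *-cong (trans (*-comm _ _) (fact-*-expS n)) refl ⟩
    1# * a                  ≈⟨ *-identityˡ a ⟩
    a                       ∎

  -- Polynomials

  HasCoeffs : Poly → (ℕ → K) → Set ℓ
  HasCoeffs f a = ∀ k → coeff f k ≈ a k

  truncate-< : ∀ f N k → k < N → truncate f N k ≈ f k
  truncate-< f N k k<N with k <? N
  ... | yes _   = refl
  ... | no  k≮N = contradiction k<N k≮N

  truncate-of-vanishing : ∀ f N → VanishesFrom f N → HasCoeffs (mkPoly f N) f
  truncate-of-vanishing f N van k with k <? N
  ... | yes _   = refl
  ... | no  k≮N = sym (van k (ℕ.≮⇒≥ k≮N))

  coeff-0ₚ : HasCoeffs 0ₚ (λ _ → 0#)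
  coeff-0ₚ = truncate-of-vanishing (λ _ → 0#) 1 (λ _ _ → refl)

  coeff-+ₚ : ∀ f g → HasCoeffs (f +ₚ g) (λ k → coeff f k + coeff g k)
  coeff-+ₚ f g = truncate-of-vanishing _ (bound f ⊔ℕ bound g) λ k le →
    trans (+-cong (vanish f k (ℕ.≤-trans (ℕ.m≤m⊔n (bound f) (bound g)) le))
                  (vanish g k (ℕ.≤-trans (ℕ.m≤n⊔m (bound f) (bound g)) le)))
          (+-identityˡ 0#)

  coeff-·ₚ : ∀ a f → HasCoeffs (a ·ₚ f) (λ k → a * coeff f k)
  coeff-·ₚ a f = truncate-of-vanishing _ (bound f) λ k le →
    trans (*-cong refl (vanish f k le)) (zeroʳ a)

  coeff-*ₚ : ∀ f g → HasCoeffs (f *ₚ g) (λ k → sumK (suc k) (λ i → coeff f i * coeff g (k ∸ i)))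
  coeff-*ₚ f g = truncate-of-vanishing _ (bound f +ℕ bound g) λ k le →
    sumK-zero (suc k) (λ i _ → term-vanishes k le i)
    where
    term-vanishes : ∀ k → bound f +ℕ bound g ≤ k → ∀ i → coeff f i * coeff g (k ∸ i) ≈ 0#
    term-vanishes k le i with i <? bound f
    ... | no  i≮bf = trans (*-cong (vanish f i (ℕ.≮⇒≥ i≮bf)) refl) (zeroˡ _)
    ... | yes i<bf = trans (*-cong refl (vanish g (k ∸ i) bg≤k∸i)) (zeroʳ _)
      where
      bg≤k∸i : bound g ≤ k ∸ i
      bg≤k∸i = ℕ.m+n≤o⇒m≤o∸n (bound g) (ℕ.≤-trans (ℕ.≤-reflexive (ℕ.+-comm (bound g) i))
                 (ℕ.≤-trans (ℕ.+-monoˡ-≤ (bound g) (ℕ.<⇒≤ i<bf)) le))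

  coeff-sumP : ∀ N F → HasCoeffs (sumP N F) (λ k → sumK N (λ n → coeff (F n) k))
  coeff-sumP zero    F k = coeff-0ₚ k
  coeff-sumP (suc N) F k = trans (coeff-+ₚ (sumP N F) (F N) k) (+-cong (coeff-sumP N F k) refl)

  coeff-Dx : ∀ f → HasCoeffs (Dx f) (λ k → ι (suc k) * coeff f (suc k))
  coeff-Dx f = truncate-of-vanishing _ (bound f) λ k le →
    trans (*-cong refl (vanish f (suc k) (ℕ.m≤n⇒m≤1+n le))) (zeroʳ _)

  coeff-·xP : ∀ a → HasCoeffs (a ·ₚ xP) (λ l → ifEq l 1 a)
  coeff-·xP a l = begin
    coeff (a ·ₚ xP) l  ≈⟨ coeff-·ₚ a xP l ⟩
    a * coeff xP l     ≈⟨ *-cong refl coeff-xP ⟩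
    a * ifEq l 1 1#    ≈⟨ *-ifEq l 1 a 1# ⟩
    ifEq l 1 (a * 1#)  ≈⟨ ifEq-cong l 1 (*-identityʳ a) ⟩
    ifEq l 1 a         ∎
    where
    coeff-xP : coeff xP l ≈ ifEq l 1 1#
    coeff-xP = truncate-of-vanishing _ 2
      (λ k 2≤k → ifEq-≢ k 1 1# λ { ≡.refl → ℕ.<⇒≱ ℕ.≤-refl 2≤k }) l

  coeff-·xP-*ₚ-zero : ∀ a g → coeff ((a ·ₚ xP) *ₚ g) 0 ≈ 0#
  coeff-·xP-*ₚ-zero a g = begin
    coeff ((a ·ₚ xP) *ₚ g) 0          ≈⟨ coeff-*ₚ (a ·ₚ xP) g 0 ⟩
    0# + coeff (a ·ₚ xP) 0 * coeff g 0 ≈⟨ +-identityˡ _ ⟩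
    coeff (a ·ₚ xP) 0 * coeff g 0      ≈⟨ *-cong (trans (coeff-·xP a 0) (ifEq-≢ 0 1 a λ ())) refl ⟩
    0# * coeff g 0                     ≈⟨ zeroˡ _ ⟩
    0#                                 ∎

  coeff-·xP-*ₚ-suc : ∀ a g k → coeff ((a ·ₚ xP) *ₚ g) (suc k) ≈ a * coeff g k
  coeff-·xP-*ₚ-suc a g k = begin
    coeff ((a ·ₚ xP) *ₚ g) (suc k)
      ≈⟨ coeff-*ₚ (a ·ₚ xP) g (suc k) ⟩
    sumK (suc (suc k)) (λ l → coeff (a ·ₚ xP) l * coeff g (suc k ∸ l))
      ≈⟨ sumK-cong (suc (suc k)) (λ l _ → trans (*-cong (coeff-·xP a l) refl) (ifEq-*ʳ l)) ⟩
    sumK (suc (suc k)) (λ l → ifEq 1 l (a * coeff g (suc k ∸ l)))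
      ≈⟨ sumK-ifEq-< (suc (suc k)) 1 _ (s≤s (s≤s z≤n)) ⟩
    a * coeff g k
      ∎
    where
    ifEq-*ʳ : ∀ l → ifEq l 1 a * coeff g (suc k ∸ l) ≈ ifEq 1 l (a * coeff g (suc k ∸ l))
    ifEq-*ʳ l with l ≟ 1 | 1 ≟ l
    ... | yes _     | yes _   = refl
    ... | no  _     | no  _   = zeroˡ _
    ... | yes l≡1   | no  1≢l = contradiction (≡.sym l≡1) 1≢l
    ... | no  l≢1   | yes 1≡l = contradiction (≡.sym 1≡l) l≢1

  eval-bound : ∀ w f N → VanishesFrom (coeff f) N → eval w f ≈ sumK N (λ j → coeff f j * pow w j)
  eval-bound w f N van = sumK-support (bound f) N (term-vanishes (vanish f)) (term-vanishes van)
    where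
    term-vanishes : ∀ {M} → VanishesFrom (coeff f) M → VanishesFrom (λ j → coeff f j * pow w j) M
    term-vanishes van′ j le = trans (*-cong (van′ j le) refl) (zeroˡ _)

  eval-cong : ∀ w f g → f ≈ₚ g → eval w f ≈ eval w g
  eval-cong w f g f≈g = trans (sumK-cong (bound f) (λ j _ → *-cong (f≈g j) refl))
    (sym (eval-bound w g (bound f) (λ k le → trans (sym (f≈g k)) (vanish f k le))))

  eval-+ₚ : ∀ w f g → eval w (f +ₚ g) ≈ eval w f + eval w g
  eval-+ₚ w f g = begin
    eval w (f +ₚ g)
      ≈⟨ sumK-cong M (λ j _ → trans (*-cong (coeff-+ₚ f g j) refl) (distribʳ _ _ _)) ⟩
    sumK M (λ j → coeff f j * pow w j + coeff g j * pow w j)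
      ≈⟨ sumK-+ M _ _ ⟩
    sumK M (λ j → coeff f j * pow w j) + sumK M (λ j → coeff g j * pow w j)
      ≈⟨ sym (+-cong (eval-bound w f M (vanishesFrom-mono (ℕ.m≤m⊔n (bound f) (bound g)) (vanish f)))
                     (eval-bound w g M (vanishesFrom-mono (ℕ.m≤n⊔m (bound f) (bound g)) (vanish g)))) ⟩
    eval w f + eval w g
      ∎
    where
    M : ℕ
    M = bound f ⊔ℕ bound g

  eval-·ₚ : ∀ w a f → eval w (a ·ₚ f) ≈ a * eval w f
  eval-·ₚ w a f = trans
    (sumK-cong (bound f) (λ j _ → trans (*-cong (coeff-·ₚ a f j) refl) (*-assoc _ _ _)))
    (sym (*-distribˡ-sumK (bound f) a _))

  eval-vanishing : ∀ w f → VanishesFrom (coeff f) 0 → eval w f ≈ 0#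
  eval-vanishing w f van = sumK-zero (bound f) (λ j _ → trans (*-cong (van j z≤n) refl) (zeroˡ _))

  eval-sumP : ∀ w N F → eval w (sumP N F) ≈ sumK N (λ n → eval w (F n))
  eval-sumP w zero    F = eval-vanishing w 0ₚ (λ k _ → coeff-0ₚ k)
  eval-sumP w (suc N) F = trans (eval-+ₚ w (sumP N F) (F N)) (+-cong (eval-sumP w N F) refl)

  -- Linear operators and Gončarov interpolation

  infixl 6 _-ₚ_
  _-ₚ_ : Poly → Poly → Poly
  f -ₚ g = f +ₚ (- 1#) ·ₚ g

  coeff--ₚ : ∀ f g → HasCoeffs (f -ₚ g) (λ k → coeff f k + - 1# * coeff g k)
  coeff--ₚ f g k = trans (coeff-+ₚ f ((- 1#) ·ₚ g) k) (+-cong refl (coeff-·ₚ (- 1#) g k))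

  module LinearOperator {T : Poly → Poly} (linear : IsLinear T) where
    private
      T-cong : ∀ f g → f ≈ₚ g → T f ≈ₚ T g
      T-cong = proj₁ linear
      T-+ₚ : ∀ f g → T (f +ₚ g) ≈ₚ T f +ₚ T g
      T-+ₚ = proj₁ (proj₂ linear)
      T-·ₚ : ∀ a f → T (a ·ₚ f) ≈ₚ a ·ₚ T f
      T-·ₚ = proj₂ (proj₂ linear)

    iter-cong : ∀ i {f g} → f ≈ₚ g → iter T i f ≈ₚ iter T i g
    iter-cong zero    f≈g = f≈g
    iter-cong (suc i) f≈g = T-cong _ _ (iter-cong i f≈g)

    iter-+ₚ : ∀ i f g → iter T i (f +ₚ g) ≈ₚ iter T i f +ₚ iter T i g
    iter-+ₚ zero    f g k = refl
    iter-+ₚ (suc i) f g k =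
      trans (T-cong _ _ (iter-+ₚ i f g) k) (T-+ₚ (iter T i f) (iter T i g) k)

    iter-·ₚ : ∀ i a f → iter T i (a ·ₚ f) ≈ₚ a ·ₚ iter T i f
    iter-·ₚ zero    a f k = refl
    iter-·ₚ (suc i) a f k = trans (T-cong _ _ (iter-·ₚ i a f) k) (T-·ₚ a (iter T i f) k)

    iter-suc-inner : ∀ i f → iter T (suc i) f ≈ₚ iter T i (T f)
    iter-suc-inner zero    f k = refl
    iter-suc-inner (suc i) f   = T-cong _ _ (iter-suc-inner i f)

    iter-vanishing : ∀ i f → VanishesFrom (coeff f) 0 → VanishesFrom (coeff (iter T i f)) 0
    iter-vanishing i f van k _ = begin
      coeff (iter T i f) k            ≈⟨ iter-cong i f≈0·f k ⟩
      coeff (iter T i (0# ·ₚ f)) k    ≈⟨ iter-·ₚ i 0# f k ⟩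
      coeff (0# ·ₚ iter T i f) k      ≈⟨ coeff-·ₚ 0# (iter T i f) k ⟩
      0# * coeff (iter T i f) k       ≈⟨ zeroˡ _ ⟩
      0#                              ∎
      where
      f≈0·f : f ≈ₚ 0# ·ₚ f
      f≈0·f k = trans (van k z≤n) (sym (trans (coeff-·ₚ 0# f k) (zeroˡ _)))

    iter-sumP : ∀ i N F → iter T i (sumP N F) ≈ₚ sumP N (λ n → iter T i (F n))
    iter-sumP i zero    F k =
      trans (iter-vanishing i 0ₚ (λ k _ → coeff-0ₚ k) k z≤n) (sym (coeff-0ₚ k))
    iter-sumP i (suc N) F k = begin
      coeff (iter T i (sumP N F +ₚ F N)) k
        ≈⟨ iter-+ₚ i (sumP N F) (F N) k ⟩
      coeff (iter T i (sumP N F) +ₚ iter T i (F N)) k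
        ≈⟨ coeff-+ₚ (iter T i (sumP N F)) (iter T i (F N)) k ⟩
      coeff (iter T i (sumP N F)) k + coeff (iter T i (F N)) k
        ≈⟨ +-cong (iter-sumP i N F k) refl ⟩
      coeff (sumP N (λ n → iter T i (F n))) k + coeff (iter T i (F N)) k
        ≈⟨ sym (coeff-+ₚ (sumP N _) (iter T i (F N)) k) ⟩
      coeff (sumP (suc N) (λ n → iter T i (F n))) k
        ∎

  LowersDegree : (Poly → Poly) → Set (c Level.⊔ ℓ)
  LowersDegree T = ∀ N f → VanishesFrom (coeff f) (suc N) → VanishesFrom (coeff (T f)) N

  iter-lowersDegree : ∀ {T} → LowersDegree T →
                      ∀ i N f → VanishesFrom (coeff f) (i +ℕ N) → VanishesFrom (coeff (iter T i f)) N
  iter-lowersDegree lowers zero    N f van = van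
  iter-lowersDegree lowers (suc i) N f van = lowers N _ (iter-lowersDegree lowers i (suc N) f
    (vanishesFrom-mono (ℕ.≤-reflexive (≡.sym (ℕ.+-suc i N))) van))

  module Goncarov {T : Poly → Poly} (linear : IsLinear T) (lowers : LowersDegree T)
                  {z : ℕ → K} {t : ℕ → Poly} (basis : IsGoncarovBasis T z t) where
    open LinearOperator {T = T} linear

    φ : ℕ → Poly → K
    φ i f = eval (z i) (iter T i f)

    φ-·ₚ : ∀ i a f → φ i (a ·ₚ f) ≈ a * φ i f
    φ-·ₚ i a f = trans (eval-cong (z i) (iter T i (a ·ₚ f)) (a ·ₚ iter T i f) (iter-·ₚ i a f))
                       (eval-·ₚ (z i) a (iter T i f))

    φ--ₚ : ∀ i f g → φ i (f -ₚ g) ≈ φ i f + - 1# * φ i g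
    φ--ₚ i f g = begin
      φ i (f -ₚ g)
        ≈⟨ eval-cong (z i) (iter T i (f -ₚ g)) (iter T i f +ₚ iter T i -g) (iter-+ₚ i f -g) ⟩
      eval (z i) (iter T i f +ₚ iter T i -g)
        ≈⟨ eval-+ₚ (z i) (iter T i f) (iter T i -g) ⟩
      φ i f + φ i -g
        ≈⟨ +-cong refl (φ-·ₚ i (- 1#) g) ⟩
      φ i f + - 1# * φ i g
        ∎
      where
      -g : Poly
      -g = (- 1#) ·ₚ g

    φ-basis : ∀ i n a → φ i (a ·ₚ t n) ≈ ifEq i n (a * fact n)
    φ-basis i n a = trans (φ-·ₚ i a (t n)) (trans (*-cong refl (proj₂ (basis n) i)) (*-ifEq i n a _))

    φ-combination : ∀ i N (a : ℕ → K) →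
                    φ i (sumP N (λ n → a n ·ₚ t n)) ≈ sumK N (λ n → ifEq i n (a n * fact n))
    φ-combination i N a = begin
      φ i (sumP N (λ n → a n ·ₚ t n))
        ≈⟨ eval-cong (z i) (iter T i (sumP N _)) (sumP N _) (iter-sumP i N _) ⟩
      eval (z i) (sumP N (λ n → iter T i (a n ·ₚ t n)))
        ≈⟨ eval-sumP (z i) N _ ⟩
      sumK N (λ n → φ i (a n ·ₚ t n))
        ≈⟨ sumK-cong N (λ n _ → φ-basis i n (a n)) ⟩
      sumK N (λ n → ifEq i n (a n * fact n))
        ∎

    -- ε_{z_M} 𝔡^M only sees the coefficient of x^M, through that of t_M.
    φ-top : ∀ M r a → VanishesFrom (coeff r) (suc M) → a * coeff (t M) M ≈ coeff r M →
            φ M r ≈ a * fact M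
    φ-top M r a van top = x+-1y≈0⇒x≈y (begin
      φ M r + - 1# * (a * fact M)       ≈⟨ +-cong refl (*-cong refl φ-at) ⟩
      φ M r + - 1# * φ M (a ·ₚ t M)     ≈⟨ sym (φ--ₚ M r _) ⟩
      φ M rest                          ≈⟨ eval-vanishing (z M) (iter T M rest) rest-killed ⟩
      0#                                ∎)
      where
      rest : Poly
      rest = r -ₚ a ·ₚ t M
      φ-at : a * fact M ≈ φ M (a ·ₚ t M)
      φ-at = sym (trans (φ-basis M M a) (ifEq-≡ M M _ ≡.refl))
      rest-vanishes : VanishesFrom (coeff rest) M
      rest-vanishes k M≤k with ℕ.m≤n⇒m<n∨m≡n M≤k
      ... | inj₁ M<k = trans (coeff--ₚ r (a ·ₚ t M) k)
              (trans (+-cong (van k M<k) (trans (*-cong refl (coeff-·ₚ a (t M) k))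
                                              (zeroʳ-nested (- 1#) a (proj₂ (proj₁ (basis M)) k M<k))))
                     (+-identityʳ 0#))
      ... | inj₂ ≡.refl = trans (coeff--ₚ r (a ·ₚ t M) M)
              (x≈y⇒x+-1y≈0 (trans (sym top) (sym (coeff-·ₚ a (t M) M))))
      rest-killed : VanishesFrom (coeff (iter T M rest)) 0
      rest-killed = iter-lowersDegree lowers M 0 rest (vanishesFrom-mono (ℕ.m≤m+n M 0) rest-vanishes)

    separates : ∀ N r → VanishesFrom (coeff r) N → (∀ i → φ i r ≈ 0#) → VanishesFrom (coeff r) 0
    separates zero    r van φ≈0 = van
    separates (suc M) r van φ≈0 = separates M r (vanishesFrom-pred van top≈0) φ≈0
      where
      lead a : K
      lead = coeff (t M) M
      a    = coeff r M * lead ⁻¹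
      a-lead : a * lead ≈ coeff r M
      a-lead = trans (*-assoc _ _ _) (trans (*-cong refl
        (trans (*-comm _ _) (inverseʳ lead (proj₁ (proj₁ (basis M)))))) (*-identityʳ _))
      a≈0 : a ≈ 0#
      a≈0 = noZeroDivisorʳ (fact≉0 M) (trans (sym (φ-top M r a van a-lead)) (φ≈0 M))
      top≈0 : coeff r M ≈ 0#
      top≈0 = trans (sym a-lead) (trans (*-cong a≈0 refl) (zeroˡ _))

    unique : ∀ {f g} → (∀ i → φ i f ≈ φ i g) → f ≈ₚ g
    unique {f} {g} φf≈φg k = x+-1y≈0⇒x≈y (trans (sym (coeff--ₚ f g k))
      (separates (bound (f -ₚ g)) (f -ₚ g) (vanish (f -ₚ g))
                 (λ i → trans (φ--ₚ i f g) (x≈y⇒x+-1y≈0 (φf≈φg i))) k z≤n))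

  -- Operators given by a D-indicator

  -- the factor (k+1)(k+2)⋯(k+j) that D^j brings down from x^{k+j}
  risingFrom : ℕ → ℕ → K
  risingFrom zero    k = 1#
  risingFrom (suc j) k = ι (suc k) * risingFrom j (suc k)

  coeff-iter-Dx : ∀ j f → HasCoeffs (iter Dx j f) (λ k → risingFrom j k * coeff f (k +ℕ j))
  coeff-iter-Dx zero    f k =
    trans (reflexive (≡.cong (coeff f) (≡.sym (ℕ.+-identityʳ k)))) (sym (*-identityˡ _))
  coeff-iter-Dx (suc j) f k = begin
    coeff (Dx (iter Dx j f)) k                                  ≈⟨ coeff-Dx (iter Dx j f) k ⟩
    ι (suc k) * coeff (iter Dx j f) (suc k)                     ≈⟨ *-cong refl (coeff-iter-Dx j f (suc k)) ⟩
    ι (suc k) * (risingFrom j (suc k) * coeff f (suc k +ℕ j))   ≈⟨ sym (*-assoc _ _ _) ⟩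
    risingFrom (suc j) k * coeff f (suc k +ℕ j)
      ≈⟨ *-cong refl (reflexive (≡.cong (coeff f) (≡.sym (ℕ.+-suc k j)))) ⟩
    risingFrom (suc j) k * coeff f (k +ℕ suc j)                 ∎

  risingFrom-fact : ∀ j k → risingFrom j k * fact k ≈ fact (k +ℕ j)
  risingFrom-fact zero    k =
    trans (*-identityˡ _) (reflexive (≡.cong fact (≡.sym (ℕ.+-identityʳ k))))
  risingFrom-fact (suc j) k = begin
    (ι (suc k) * risingFrom j (suc k)) * fact k   ≈⟨ *-swapʳ _ _ _ ⟩
    ι (suc k) * (fact k * risingFrom j (suc k))   ≈⟨ sym (*-assoc _ _ _) ⟩
    (ι (suc k) * fact k) * risingFrom j (suc k)   ≈⟨ *-cong (sym (ι-* (suc k) (k !))) refl ⟩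
    fact (suc k) * risingFrom j (suc k)           ≈⟨ *-comm _ _ ⟩
    risingFrom j (suc k) * fact (suc k)           ≈⟨ risingFrom-fact j (suc k) ⟩
    fact (suc k +ℕ j)                             ≈⟨ reflexive (≡.cong fact (≡.sym (ℕ.+-suc k j))) ⟩
    fact (k +ℕ suc j)                             ∎

  risingFrom-expS : ∀ j k → risingFrom j k * expS (k +ℕ j) ≈ expS k
  risingFrom-expS j k = begin
    risingFrom j k * expS (k +ℕ j)                          ≈⟨ sym (*-identityʳ _) ⟩
    (risingFrom j k * expS (k +ℕ j)) * 1#                   ≈⟨ *-cong refl (sym (fact-*-expS k)) ⟩
    (risingFrom j k * expS (k +ℕ j)) * (fact k * expS k)    ≈⟨ *-interchange _ _ _ _ ⟩
    (risingFrom j k * fact k) * (expS (k +ℕ j) * expS k)    ≈⟨ *-cong (risingFrom-fact j k) refl ⟩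
    fact (k +ℕ j) * (expS (k +ℕ j) * expS k)                ≈⟨ sym (*-assoc _ _ _) ⟩
    (fact (k +ℕ j) * expS (k +ℕ j)) * expS k                ≈⟨ *-cong (fact-*-expS (k +ℕ j)) refl ⟩
    1# * expS k                                             ≈⟨ *-identityˡ _ ⟩
    expS k                                                  ∎

  module _ {δ : Poly → Poly} {q : PS K} (indicator : IsDIndicator q δ) where

    coeff-indicator : ∀ f → HasCoeffs (δ f)
      (λ k → sumK (suc (bound f)) (λ j → q j * (risingFrom j k * coeff f (k +ℕ j))))
    coeff-indicator f k = trans (indicator f k) (trans (coeff-sumP (suc (bound f)) _ k)
      (sumK-cong (suc (bound f)) λ j _ →
        trans (coeff-·ₚ (q j) (iter Dx j f) k) (*-cong refl (coeff-iter-Dx j f k))))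

    indicator-lowersDegree : q 0 ≈ 0# → LowersDegree δ
    indicator-lowersDegree q0≈0 N f van k N≤k =
      trans (coeff-indicator f k) (sumK-zero (suc (bound f)) term-vanishes)
      where
      term-vanishes : ∀ j → j < suc (bound f) → q j * (risingFrom j k * coeff f (k +ℕ j)) ≈ 0#
      term-vanishes zero    _ = trans (*-cong q0≈0 refl) (zeroˡ _)
      term-vanishes (suc j) _ = zeroʳ-nested (q (suc j)) _ (van _
        (ℕ.≤-trans (s≤s (ℕ.≤-trans N≤k (ℕ.m≤m+n k j)))
                   (ℕ.≤-reflexive (≡.sym (ℕ.+-suc k j)))))

  -- Formal power series

  compS-tS⇒q0≈0 : ∀ {q d} → (∀ m → compS q d m ≈ tS m) → q 0 ≈ 0#
  compS-tS⇒q0≈0 {q} {d} q∘d≈t = begin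
    q 0                       ≈⟨ sym (*-identityʳ _) ⟩
    q 0 * 1#                  ≈⟨ *-cong refl (sym (ifEq-≡ 0 0 1# ≡.refl)) ⟩
    q 0 * powS d 0 0          ≈⟨ sym (+-identityˡ _) ⟩
    compS q d 0               ≈⟨ q∘d≈t 0 ⟩
    tS 0                      ≈⟨ ifEq-≢ 0 1 1# (λ ()) ⟩
    0#                        ∎

  powS-vanishes : ∀ {d} → d 0 ≈ 0# → ∀ n s → s < n → powS d n s ≈ 0#
  powS-vanishes {d} d0≈0 (suc n) s s<1+n = sumK-zero (suc s) (term-vanishes s s<1+n)
    where
    term-vanishes : ∀ s → s < suc n → ∀ i → i < suc s → d i * powS d n (s ∸ i) ≈ 0#
    term-vanishes s        _     zero    _         = trans (*-cong d0≈0 refl) (zeroˡ _)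
    term-vanishes zero     _     (suc i) (s≤s ())
    term-vanishes (suc s′) s<1+n (suc i) _         = trans (*-cong refl
      (powS-vanishes d0≈0 n (s′ ∸ i) (ℕ.≤-<-trans (ℕ.m∸n≤m s′ i) (ℕ.≤-pred s<1+n))))
      (zeroʳ _)

  powS-scale : ∀ w d j s → powS (λ r → w * d r) j s ≈ pow w j * powS d j s
  powS-scale w d zero    s = sym (*-identityˡ _)
  powS-scale w d (suc j) s = begin
    sumK (suc s) (λ i → (w * d i) * powS (λ r → w * d r) j (s ∸ i))
      ≈⟨ sumK-cong (suc s) (λ i _ → *-cong refl (powS-scale w d j (s ∸ i))) ⟩
    sumK (suc s) (λ i → (w * d i) * (pow w j * powS d j (s ∸ i)))
      ≈⟨ sumK-cong (suc s) (λ i _ → *-interchange _ _ _ _) ⟩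
    sumK (suc s) (λ i → (w * pow w j) * (d i * powS d j (s ∸ i)))
      ≈⟨ sym (*-distribˡ-sumK (suc s) _ _) ⟩
    pow w (suc j) * powS d (suc j) s
      ∎

  timesT : PS K → PS K
  timesT h zero    = 0#
  timesT h (suc m) = h m

  tS≈timesT-oneS : ∀ m → tS m ≈ timesT oneS m
  tS≈timesT-oneS zero    = ifEq-≢ 0 1 1# (λ ())
  tS≈timesT-oneS (suc m) = ifEq-suc m 0 1#

  mulS-timesT : ∀ f g m → mulS f (timesT g) m ≈ timesT (mulS f g) m
  mulS-timesT f g zero    = trans (+-identityˡ _) (zeroʳ _)
  mulS-timesT f g (suc m) = begin
    sumK (suc m) (λ i → f i * timesT g (suc m ∸ i)) + f (suc m) * timesT g (suc m ∸ suc m)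
      ≈⟨ +-cong (sumK-cong (suc m) (λ i i≤m → *-cong refl (reflexive (≡.cong (timesT g)
                  (ℕ.+-∸-assoc 1 (ℕ.≤-pred i≤m))))))
                (trans (*-cong refl (reflexive (≡.cong (timesT g) (ℕ.n∸n≡0 m)))) (zeroʳ _)) ⟩
    mulS f g m + 0#
      ≈⟨ +-identityʳ _ ⟩
    mulS f g m
      ∎

  -- q(d(t)) · d(t)^k = t · d(t)^k, coefficientwise
  compS-tS-powS : ∀ {q d} → d 0 ≈ 0# → (∀ m → compS q d m ≈ tS m) →
                  ∀ k m → sumK (suc m) (λ j → q j * powS d (k +ℕ j) m) ≈ timesT (powS d k) m
  compS-tS-powS {q} {d} d0≈0 q∘d≈t zero    m = trans (q∘d≈t m) (tS≈timesT-oneS m)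
  compS-tS-powS {q} {d} d0≈0 q∘d≈t (suc k) m = begin
    sumK (suc m) (λ j → q j * sumK (suc m) (λ i → d i * powS d (k +ℕ j) (m ∸ i)))
      ≈⟨ sumK-cong (suc m) (λ j _ → *-distribˡ-sumK (suc m) (q j) _) ⟩
    sumK (suc m) (λ j → sumK (suc m) (λ i → q j * (d i * powS d (k +ℕ j) (m ∸ i))))
      ≈⟨ sumK-comm (suc m) (suc m) _ ⟩
    sumK (suc m) (λ i → sumK (suc m) (λ j → q j * (d i * powS d (k +ℕ j) (m ∸ i))))
      ≈⟨ sumK-cong (suc m) (λ i _ → trans (sumK-cong (suc m) (λ j _ → *-exchange _ _ _))
                                          (sym (*-distribˡ-sumK (suc m) (d i) _))) ⟩
    sumK (suc m) (λ i → d i * sumK (suc m) (λ j → q j * powS d (k +ℕ j) (m ∸ i)))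
      ≈⟨ sumK-cong (suc m) (λ i _ → *-cong refl (sumK-extend (suc (m ∸ i)) (suc m)
                                                 (s≤s (ℕ.m∸n≤m m i)) (high-vanishes i))) ⟩
    sumK (suc m) (λ i → d i * sumK (suc (m ∸ i)) (λ j → q j * powS d (k +ℕ j) (m ∸ i)))
      ≈⟨ sumK-cong (suc m) (λ i _ → *-cong refl (compS-tS-powS d0≈0 q∘d≈t k (m ∸ i))) ⟩
    mulS d (timesT (powS d k)) m
      ≈⟨ mulS-timesT d (powS d k) m ⟩
    timesT (powS d (suc k)) m
      ∎
    where
    high-vanishes : ∀ i → VanishesFrom (λ j → q j * powS d (k +ℕ j) (m ∸ i)) (suc (m ∸ i))
    high-vanishes i j m∸i<j = trans (*-cong refl
      (powS-vanishes d0≈0 (k +ℕ j) (m ∸ i) (ℕ.≤-trans m∸i<j (ℕ.m≤n+m j k)))) (zeroʳ _)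

  -- The series e^{x d(t)}

  module Expansion {δ : Poly → Poly} {q d : PS K} (linear : IsLinear δ)
                   (indicator : IsDIndicator q δ)
                   (d0≈0 : d 0 ≈ 0#) (q∘d≈t : ∀ m → compS q d m ≈ tS m) where
    open LinearOperator {T = δ} linear

    -- the coefficient of x^k t^m in e^{x d(t)}
    expXdCoeff : ℕ → ℕ → K
    expXdCoeff m k = expS k * powS d k m

    expXdCoeff-vanishes : ∀ m → VanishesFrom (expXdCoeff m) (suc m)
    expXdCoeff-vanishes m k m<k = trans (*-cong refl (powS-vanishes d0≈0 k m m<k)) (zeroʳ _)

    xd : PS Poly
    xd r = d r ·ₚ xP

    coeff-powSP-xd : ∀ j m → HasCoeffs (powSP xd j m) (λ k → ifEq k j (powS d j m))
    coeff-powSP-xd zero    m zero    =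
      trans (truncate-< (λ _ → oneS m) 1 0 (s≤s z≤n)) (sym (ifEq-≡ 0 0 _ ≡.refl))
    coeff-powSP-xd zero    m (suc k) =
      trans (truncate-vanish (λ _ → oneS m) 1 (suc k) (s≤s z≤n))
            (sym (ifEq-≢ (suc k) 0 (oneS m) λ ()))
    coeff-powSP-xd (suc j) m zero    = trans (coeff-sumP (suc m) (λ i → xd i *ₚ powSP xd j (m ∸ i)) 0)
      (trans (sumK-zero (suc m) (λ i _ → coeff-·xP-*ₚ-zero (d i) (powSP xd j (m ∸ i))))
             (sym (ifEq-≢ 0 (suc j) (powS d (suc j) m) λ ())))
    coeff-powSP-xd (suc j) m (suc k) = begin
      coeff (powSP xd (suc j) m) (suc k)
        ≈⟨ coeff-sumP (suc m) (λ i → xd i *ₚ powSP xd j (m ∸ i)) (suc k) ⟩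
      sumK (suc m) (λ i → coeff (xd i *ₚ powSP xd j (m ∸ i)) (suc k))
        ≈⟨ sumK-cong (suc m) (λ i _ → trans (coeff-·xP-*ₚ-suc (d i) (powSP xd j (m ∸ i)) k)
             (trans (*-cong refl (coeff-powSP-xd j (m ∸ i) k)) (*-ifEq k j _ _))) ⟩
      sumK (suc m) (λ i → ifEq k j (d i * powS d j (m ∸ i)))
        ≈⟨ sumK-ifEq (suc m) k j _ ⟩
      ifEq k j (powS d (suc j) m)
        ≈⟨ sym (ifEq-suc k j _) ⟩
      ifEq (suc k) (suc j) (powS d (suc j) m)
        ∎

    coeff-expXd : ∀ m → HasCoeffs (expXd d m) (expXdCoeff m)
    coeff-expXd m k = begin
      coeff (expXd d m) k
        ≈⟨ coeff-sumP (suc m) (λ j → expS j ·ₚ powSP xd j m) k ⟩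
      sumK (suc m) (λ j → coeff (expS j ·ₚ powSP xd j m) k)
        ≈⟨ sumK-cong (suc m) (λ j _ → trans (coeff-·ₚ (expS j) (powSP xd j m) k)
             (trans (*-cong refl (coeff-powSP-xd j m k)) (*-ifEq k j _ _))) ⟩
      sumK (suc m) (λ j → ifEq k j (expXdCoeff m j))
        ≈⟨ select ⟩
      expXdCoeff m k
        ∎
      where
      select : sumK (suc m) (λ j → ifEq k j (expXdCoeff m j)) ≈ expXdCoeff m k
      select with k <? suc m
      ... | yes k<1+m = sumK-ifEq-< (suc m) k _ k<1+m
      ... | no  k≮1+m = trans (sumK-ifEq-≥ (suc m) k _ (ℕ.≮⇒≥ k≮1+m))
                              (sym (expXdCoeff-vanishes m k (ℕ.≮⇒≥ k≮1+m)))

    δ-expXdCoeff : ∀ m f → HasCoeffs f (expXdCoeff m) →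
                   HasCoeffs (δ f) (λ k → expS k * timesT (powS d k) m)
    δ-expXdCoeff m f f≈A k = begin
      coeff (δ f) k
        ≈⟨ coeff-indicator {δ = δ} indicator f k ⟩
      sumK (suc (bound f)) term
        ≈⟨ sumK-support (suc (bound f)) (suc m) beyond-bound beyond-m ⟩
      sumK (suc m) term
        ≈⟨ sumK-cong (suc m) (λ j _ → rearrange j) ⟩
      sumK (suc m) (λ j → expS k * (q j * powS d (k +ℕ j) m))
        ≈⟨ sym (*-distribˡ-sumK (suc m) (expS k) _) ⟩
      expS k * sumK (suc m) (λ j → q j * powS d (k +ℕ j) m)
        ≈⟨ *-cong refl (compS-tS-powS d0≈0 q∘d≈t k m) ⟩
      expS k * timesT (powS d k) m
        ∎
      where
      term : ℕ → K
      term j = q j * (risingFrom j k * coeff f (k +ℕ j))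
      beyond-bound : VanishesFrom term (suc (bound f))
      beyond-bound j le = zeroʳ-nested (q j) _
        (vanish f (k +ℕ j) (ℕ.≤-trans (ℕ.≤-trans (ℕ.n≤1+n _) le) (ℕ.m≤n+m j k)))
      beyond-m : VanishesFrom term (suc m)
      beyond-m j le = zeroʳ-nested (q j) _
        (trans (f≈A (k +ℕ j)) (expXdCoeff-vanishes m (k +ℕ j) (ℕ.≤-trans le (ℕ.m≤n+m j k))))
      rearrange : ∀ j → term j ≈ expS k * (q j * powS d (k +ℕ j) m)
      rearrange j = begin
        q j * (risingFrom j k * coeff f (k +ℕ j))
          ≈⟨ *-cong refl (*-cong refl (f≈A (k +ℕ j))) ⟩
        q j * (risingFrom j k * (expS (k +ℕ j) * powS d (k +ℕ j) m))
          ≈⟨ *-cong refl (sym (*-assoc _ _ _)) ⟩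
        q j * ((risingFrom j k * expS (k +ℕ j)) * powS d (k +ℕ j) m)
          ≈⟨ *-cong refl (*-cong (risingFrom-expS j k) refl) ⟩
        q j * (expS k * powS d (k +ℕ j) m)
          ≈⟨ *-exchange _ _ _ ⟩
        expS k * (q j * powS d (k +ℕ j) m)
          ∎

    iter-δ-expXdCoeff-≤ : ∀ i m f → i ≤ m → HasCoeffs f (expXdCoeff m) →
                          HasCoeffs (iter δ i f) (expXdCoeff (m ∸ i))
    iter-δ-expXdCoeff-≤ zero    m       f _         f≈A   = f≈A
    iter-δ-expXdCoeff-≤ (suc i) (suc m) f (s≤s i≤m) f≈A k = trans (iter-suc-inner i f k)
      (iter-δ-expXdCoeff-≤ i m (δ f) i≤m (δ-expXdCoeff (suc m) f f≈A) k)

    iter-δ-expXdCoeff-> : ∀ i m f → m < i → HasCoeffs f (expXdCoeff m) →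
                          VanishesFrom (coeff (iter δ i f)) 0
    iter-δ-expXdCoeff-> (suc i) zero    f _         f≈A k _ = trans (iter-suc-inner i f k)
      (iter-vanishing i (δ f) (λ k _ → trans (δ-expXdCoeff 0 f f≈A k) (zeroʳ _)) k z≤n)
    iter-δ-expXdCoeff-> (suc i) (suc m) f (s≤s m<i) f≈A k _ = trans (iter-suc-inner i f k)
      (iter-δ-expXdCoeff-> i m (δ f) m<i (δ-expXdCoeff (suc m) f f≈A) k z≤n)

    eval-expXdCoeff : ∀ w s f → HasCoeffs f (expXdCoeff s) →
                      eval w f ≈ compS expS (λ r → w * d r) s
    eval-expXdCoeff w s f f≈A = begin
      eval w f
        ≈⟨ eval-bound w f (suc s) (λ k le → trans (f≈A k) (expXdCoeff-vanishes s k le)) ⟩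
      sumK (suc s) (λ j → coeff f j * pow w j)
        ≈⟨ sumK-cong (suc s) (λ j _ → trans (*-cong (f≈A j) refl)
             (trans (*-swapʳ _ _ _) (*-cong refl (sym (powS-scale w d j s))))) ⟩
      compS expS (λ r → w * d r) s
        ∎

    eval-iter-expXd-≤ : ∀ w i m → i ≤ m →
                        eval w (iter δ i (expXd d m)) ≈ compS expS (λ r → w * d r) (m ∸ i)
    eval-iter-expXd-≤ w i m i≤m =
      eval-expXdCoeff w (m ∸ i) (iter δ i (expXd d m))
        (iter-δ-expXdCoeff-≤ i m (expXd d m) i≤m (coeff-expXd m))

    eval-iter-expXd-> : ∀ w i m → m < i → eval w (iter δ i (expXd d m)) ≈ 0#
    eval-iter-expXd-> w i m m<i =
      eval-vanishing w (iter δ i (expXd d m))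
        (iter-δ-expXdCoeff-> i m (expXd d m) m<i (coeff-expXd m))

proposition3p13 : ∀ {c ℓ} (F : CharZeroField c ℓ) → let open Theory F in
    (δ : Poly → Poly) (q d : PS K) (z : ℕ → K) (t : ℕ → Poly) →
    IsDeltaOperator δ → IsDIndicator q δ → IsCompInverse d q →
    IsGoncarovBasis δ z t →
    ∀ m → expXd d m ≈ₚ goncarovSeries d z t m
proposition3p13 F δ q d z t (linear , _) indicator (d0≈0 , q∘d≈t , _) basis m = unique φ-agree
  where
  open Theory F
  open SetoidReasoning setoid
  open Expansion F {δ = δ} {q} {d} linear indicator d0≈0 q∘d≈t
  lowers : LowersDegree F δ
  lowers = indicator-lowersDegree F {δ = δ} {q} indicator (compS-tS⇒q0≈0 F {q} {d} q∘d≈t)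
  open Goncarov F {T = δ} linear lowers {z} {t} basis
  φ-agree : ∀ i → φ i (expXd d m) ≈ φ i (goncarovSeries d z t m)
  φ-agree i with i ≤? m
  ... | yes i≤m = begin
    φ i (expXd d m)
      ≈⟨ eval-iter-expXd-≤ (z i) i m i≤m ⟩
    compS expS (λ r → z i * d r) (m ∸ i)
      ≈⟨ sym (expS-*-fact-cancel F i _) ⟩
    (expS i * compS expS (λ r → z i * d r) (m ∸ i)) * fact i
      ≈⟨ sym (sumK-ifEq-< F (suc m) i _ (s≤s i≤m)) ⟩
    sumK (suc m) (λ n → ifEq i n ((expS n * compS expS (λ r → z n * d r) (m ∸ n)) * fact n))
      ≈⟨ sym (φ-combination i (suc m) _) ⟩
    φ i (goncarovSeries d z t m)
      ∎
  ... | no  i≰m = trans (eval-iter-expXd-> (z i) i m (ℕ.≰⇒> i≰m))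
    (sym (trans (φ-combination i (suc m) _) (sumK-ifEq-≥ F (suc m) i _ (ℕ.≰⇒> i≰m))))
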